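{- Let $\mathbf z$ be the infinite fixed point, starting with $a$, of the morphism $h$ with $h(a)=aab$, $h(b)=b$. For every factor $w$ of $\mathbf z$, the longest $b$-run in $w$ has at most one interior occurrence in $w$.
   Context: A factor of an infinite word is a finite contiguous block of it. A $b$-run of a word $w$ is a maximal occurrence of a block of consecutive $b$'s in $w$ (not extendable within $w$ by a $b$ on either side). An occurrence of a $b$-run in $w$ is interior to $w$ if it is neither a prefix nor a suffix of $w$. -}

module Defs where

open import Data.Nat using (ℕ; zero; suc; _+_; _∸_; _≤_; _<_)
open import Data.List using (List; []; _∷_; concatMap; length)
open import Data.Maybe using (Maybe; just; nothing)
open import Data.Product using (Σ; _×_; ∃)
open import Data.Sum using (_⊎_)
open import Relation.Binary.PropositionalEquality using (_≡_)

data Letter : Set where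
  a b : Letter

h : Letter → List Letter
h a = a ∷ a ∷ b ∷ []
h b = b ∷ []

hWord : List Letter → List Letter
hWord = concatMap h

hPow : ℕ → List Letter
hPow zero    = a ∷ []
hPow (suc n) = hWord (hPow n)

_‼_ : {A : Set} → List A → ℕ → Maybe A
[]       ‼ _     = nothing
(x ∷ xs) ‼ zero  = just x
(x ∷ xs) ‼ suc i = xs ‼ i

-- Since h^n(a) is a prefix of
-- h^(n+1)(a) and |h^n(a)| = 2^(n+1) - 1 > n, the i-th letter of z is the
-- i-th letter of h^(i)(a).  (The fallback value is never used.)
fromMaybe : Maybe Letter → Letter
fromMaybe (just x) = x
fromMaybe nothing  = a

z : ℕ → Letter
z i = fromMaybe (hPow i ‼ i)

factorAt : ℕ → ℕ → List Letter
factorAt i zero    = []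
factorAt i (suc n) = z i ∷ factorAt (suc i) n

Factor : List Letter → Set
Factor w = Σ ℕ λ i → w ≡ factorAt i (length w)

IsBRun : List Letter → ℕ → ℕ → Set
IsBRun w p k =
  (1 ≤ k) × (p + k ≤ length w)
  × (∀ j → p ≤ j → j < p + k → w ‼ j ≡ just b)
  × ((p ≡ 0) ⊎ (w ‼ (p ∸ 1) ≡ just a))
  × ((p + k ≡ length w) ⊎ (w ‼ (p + k) ≡ just a))

Interior : List Letter → ℕ → ℕ → Set
Interior w p k = (0 < p) × (p + k < length w)

IsLongestBRunLength : List Letter → ℕ → Set
IsLongestBRunLength w k = (Σ ℕ λ p → IsBRun w p k) × (∀ q m → IsBRun w q m → m ≤ k)

-- Write h^(n+1)(a) = h^n(a) h^n(a) b and h^n(a) = x a bⁿ. A b-run flanked by a's in h^(n+1)(a)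
-- lies inside one of the two copies of h^n(a) or is the run bⁿ where they meet. Hence such runs
-- in h^n(a) are shorter than n, and, by induction on n, between two a-flanked b-runs of the
-- same length in z there is a longer one. Two interior occurrences of a longest b-run of a
-- factor w are flanked by a's, so that longer run would lie inside w.
module Submission where

open import Defs
open import Data.Nat using (ℕ; zero; suc; _+_; _∸_; _≤_; _≤′_; ≤′-refl; ≤′-step; _<_; _≮_; z≤n; s≤s; _<?_; _≤?_)
open import Data.Nat.Properties
open import Data.Nat.Tactic.RingSolver using (solve-∀)
open import Data.List using (List; []; _∷_; _++_; [_]; length)
open import Data.List.Properties using (length-++; concatMap-++; ++-assoc; ++-identityʳ)
open import Data.Maybe as Maybe using (just)
open import Data.Maybe.Properties using (just-injective)
open import Data.Product using (∃; _×_; _,_)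
open import Data.Sum using (_⊎_; inj₁; inj₂)
open import Data.Empty using (⊥-elim)
open import Function using (_∘_)
open import Relation.Nullary using (yes; no; contradiction)
open import Relation.Binary using (tri<; tri≈; tri>)
open import Relation.Binary.PropositionalEquality hiding ([_])

‼-++ˡ : ∀ {A : Set} (xs ys : List A) {i} → i < length xs → (xs ++ ys) ‼ i ≡ xs ‼ i
‼-++ˡ (x ∷ xs) ys {zero}  _         = refl
‼-++ˡ (x ∷ xs) ys {suc i} (s≤s i<) = ‼-++ˡ xs ys i<

‼-++ʳ : ∀ {A : Set} (xs ys : List A) {m} → length xs ≡ m → ∀ j → (xs ++ ys) ‼ (m + j) ≡ ys ‼ j
‼-++ʳ []       ys refl j = refl
‼-++ʳ (x ∷ xs) ys refl j = ‼-++ʳ xs ys refl j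

a≢b : a ≢ b
a≢b ()

hPow-suc : ∀ n → hPow (suc n) ≡ hPow n ++ hPow n ++ [ b ]
hPow-suc zero    = refl
hPow-suc (suc n) = begin
  hWord (hPow (suc n))                              ≡⟨ cong hWord (hPow-suc n) ⟩
  hWord (hPow n ++ hPow n ++ [ b ])                 ≡⟨ concatMap-++ h (hPow n) _ ⟩
  hPow (suc n) ++ hWord (hPow n ++ [ b ])           ≡⟨ cong (hPow (suc n) ++_) (concatMap-++ h (hPow n) _) ⟩
  hPow (suc n) ++ hPow (suc n) ++ [ b ]             ∎
  where open ≡-Reasoning

hPow-prefix : ∀ {m n} → m ≤′ n → ∃ λ ys → hPow n ≡ hPow m ++ ys
hPow-prefix {m} ≤′-refl = [] , sym (++-identityʳ (hPow m))
hPow-prefix {m} (≤′-step {n} m≤′n) with hPow-prefix m≤′n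
... | ys , eq = ys ++ hPow n ++ [ b ] , (begin
  hPow (suc n)                      ≡⟨ hPow-suc n ⟩
  hPow n ++ hPow n ++ [ b ]         ≡⟨ cong (_++ hPow n ++ [ b ]) eq ⟩
  (hPow m ++ ys) ++ hPow n ++ [ b ] ≡⟨ ++-assoc (hPow m) ys _ ⟩
  hPow m ++ ys ++ hPow n ++ [ b ]   ∎)
  where open ≡-Reasoning

-- h^n(a) = x a bⁿ with |x| = lastA n.
lastA : ℕ → ℕ
lastA zero    = zero
lastA (suc n) = suc (lastA n) + n + lastA n

size : ℕ → ℕ
size n = suc (lastA n) + n

size-suc : ∀ n → size (suc n) ≡ size n + size n + 1
size-suc n = lemma (lastA n) n
  where
  lemma : ∀ l n → suc (suc l + n + l) + suc n ≡ suc l + n + (suc l + n) + 1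
  lemma = solve-∀

length-hPow : ∀ n → length (hPow n) ≡ size n
length-hPow zero    = refl
length-hPow (suc n) = begin
  length (hPow (suc n))                          ≡⟨ cong length (hPow-suc n) ⟩
  length (hPow n ++ hPow n ++ [ b ])             ≡⟨ length-++ (hPow n) ⟩
  length (hPow n) + length (hPow n ++ [ b ])     ≡⟨ cong (length (hPow n) +_) (length-++ (hPow n)) ⟩
  length (hPow n) + (length (hPow n) + 1)        ≡⟨ cong (λ s → s + (s + 1)) (length-hPow n) ⟩
  size n + (size n + 1)                          ≡⟨ sym (+-assoc (size n) _ 1) ⟩
  size n + size n + 1                            ≡⟨ sym (size-suc n) ⟩
  size (suc n)                                   ∎
  where open ≡-Reasoning

-- h^n(a) b b b …: padding with b, not a, keeps runs reaching the end of h^n(a) from being a-flanked.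
hPowᵇ : ℕ → ℕ → Letter
hPowᵇ n i = Maybe.fromMaybe b (hPow n ‼ i)

hPow-suc-‼ʳ : ∀ n j → hPow (suc n) ‼ (size n + j) ≡ (hPow n ++ [ b ]) ‼ j
hPow-suc-‼ʳ n j rewrite hPow-suc n = ‼-++ʳ (hPow n) _ (length-hPow n) j

hPowᵇ-sucˡ : ∀ n {i} → i < size n → hPowᵇ (suc n) i ≡ hPowᵇ n i
hPowᵇ-sucˡ n {i} i< rewrite hPow-suc n =
  cong (Maybe.fromMaybe b) (‼-++ˡ (hPow n) _ (subst (i <_) (sym (length-hPow n)) i<))

hPowᵇ-sucʳ : ∀ n {j} → j < size n → hPowᵇ (suc n) (size n + j) ≡ hPowᵇ n j
hPowᵇ-sucʳ n {j} j< rewrite hPow-suc-‼ʳ n j =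
  cong (Maybe.fromMaybe b) (‼-++ˡ (hPow n) _ (subst (j <_) (sym (length-hPow n)) j<))

hPowᵇ-suc-tail : ∀ n {i} → size n + size n ≤ i → hPowᵇ (suc n) i ≡ b
hPowᵇ-suc-tail n le with m≤n⇒∃[o]m+o≡n le
... | e , refl = begin
  hPowᵇ (suc n) (size n + size n + e)      ≡⟨ cong (hPowᵇ (suc n)) (+-assoc (size n) (size n) e) ⟩
  hPowᵇ (suc n) (size n + (size n + e))    ≡⟨ cong (Maybe.fromMaybe b) (hPow-suc-‼ʳ n (size n + e)) ⟩
  Maybe.fromMaybe b ((hPow n ++ [ b ]) ‼ (size n + e))
    ≡⟨ cong (Maybe.fromMaybe b) (‼-++ʳ (hPow n) [ b ] (length-hPow n) e) ⟩
  Maybe.fromMaybe b ([ b ] ‼ e)            ≡⟨ only-b e ⟩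
  b                                        ∎
  where
  open ≡-Reasoning
  only-b : ∀ e → Maybe.fromMaybe b ([ b ] ‼ e) ≡ b
  only-b zero    = refl
  only-b (suc e) = refl

hPowᵇ-size : ∀ n → hPowᵇ (suc n) (size n) ≡ a
hPowᵇ-size n = trans (cong (hPowᵇ (suc n)) (sym (+-identityʳ (size n))))
                     (trans (hPowᵇ-sucʳ n (s≤s z≤n)) (hPowᵇ-zero n))
  where
  hPowᵇ-zero : ∀ n → hPowᵇ n 0 ≡ a
  hPowᵇ-zero zero    = refl
  hPowᵇ-zero (suc n) = trans (hPowᵇ-sucˡ n (s≤s z≤n)) (hPowᵇ-zero n)

lastA<size : ∀ n → lastA n < size n
lastA<size n = s≤s (m≤m+n (lastA n) n)

hPowᵇ-lastA : ∀ n → hPowᵇ n (lastA n) ≡ a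
hPowᵇ-lastA zero    = refl
hPowᵇ-lastA (suc n) = trans (hPowᵇ-sucʳ n (lastA<size n)) (hPowᵇ-lastA n)

hPowᵇ-after-lastA : ∀ n {j} → lastA n < j → hPowᵇ n j ≡ b
hPowᵇ-after-lastA zero    {suc j} _ = refl
hPowᵇ-after-lastA (suc n) {j} lastA< with j <? size n + size n
... | no j≮ = hPowᵇ-suc-tail n (≮⇒≥ j≮)
... | yes j< with m≤n⇒∃[o]m+o≡n (≤-trans (m≤m+n (size n) (lastA n)) (<⇒≤ lastA<))
...   | j₀ , refl = trans (hPowᵇ-sucʳ n (+-cancelˡ-< (size n) _ _ j<))
                          (hPowᵇ-after-lastA n (+-cancelˡ-< (size n) _ _ lastA<))

hPowᵇ-a⇒≤lastA : ∀ n {j} → hPowᵇ n j ≡ a → j ≤ lastA n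
hPowᵇ-a⇒≤lastA n {j} eq with j ≤? lastA n
... | yes le = le
... | no  gt = ⊥-elim (a≢b (trans (sym eq) (hPowᵇ-after-lastA n (≰⇒> gt))))

-- A b-run of length k flanked by a's, indexed by the position q of the a preceding it.
record Run (f : ℕ → Letter) (q k : ℕ) : Set where
  field
    a-before : f q ≡ a
    b-inside : ∀ j → q < j → j ≤ q + k → f j ≡ b
    a-after  : f (suc (q + k)) ≡ a
open Run

Run-no-a-inside : ∀ {f q k j} → Run f q k → q < j → j ≤ q + k → f j ≢ a
Run-no-a-inside R q<j j≤ fj≡a = a≢b (trans (sym fj≡a) (b-inside R _ q<j j≤))

Run-agree : ∀ {f g N q k} → (∀ {j} → j < N → f j ≡ g j) → suc (q + k) < N → Run f q k → Run g q k
Run-agree {f} {g} {N} {q} {k} f≡g end< R = record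
  { a-before = trans (sym (f≡g (≤-<-trans (≤-trans (m≤m+n q k) (n≤1+n _)) end<))) (a-before R)
  ; b-inside = λ j q<j j≤ → trans (sym (f≡g (≤-<-trans (≤-trans j≤ (n≤1+n _)) end<))) (b-inside R j q<j j≤)
  ; a-after  = trans (sym (f≡g end<)) (a-after R)
  }

+-suc-assoc : ∀ o q k → o + suc (q + k) ≡ suc (o + q + k)
+-suc-assoc o q k = trans (+-suc o (q + k)) (cong suc (sym (+-assoc o q k)))

Run-shift : ∀ {f} o {q k} → Run f (o + q) k → Run (λ j → f (o + j)) q k
Run-shift {f} o {q} {k} R = record
  { a-before = a-before R
  ; b-inside = λ j q<j j≤ → b-inside R (o + j) (+-monoʳ-< o q<j)
                 (subst (o + j ≤_) (sym (+-assoc o q k)) (+-monoʳ-≤ o j≤))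
  ; a-after  = trans (cong f (+-suc-assoc o q k)) (a-after R)
  }

Run-unshift : ∀ {f} o {q k} → Run (λ j → f (o + j)) q k → Run f (o + q) k
Run-unshift {f} o {q} {k} R = record
  { a-before = a-before R
  ; b-inside = b-inside′
  ; a-after  = trans (cong f (sym (+-suc-assoc o q k))) (a-after R)
  }
  where
  b-inside′ : ∀ j → o + q < j → j ≤ o + q + k → f j ≡ b
  b-inside′ j o+q<j j≤ with m≤n⇒∃[o]m+o≡n (≤-trans (m≤m+n o q) (<⇒≤ o+q<j))
  ... | j₀ , refl = b-inside R j₀ (+-cancelˡ-< o _ _ o+q<j)
                      (+-cancelˡ-≤ o _ _ (subst (o + j₀ ≤_) (+-assoc o q k) j≤))

Run-end≤lastA : ∀ n {q k} → Run (hPowᵇ n) q k → suc (q + k) ≤ lastA n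
Run-end≤lastA n R = hPowᵇ-a⇒≤lastA n (a-after R)

Run-end<size : ∀ n {q k} → Run (hPowᵇ n) q k → suc (q + k) < size n
Run-end<size n R = ≤-<-trans (Run-end≤lastA n R) (lastA<size n)

Run-start<size : ∀ n {q k} → Run (hPowᵇ n) q k → q < size n
Run-start<size n {q} {k} R = <-trans (s≤s (m≤m+n q k)) (Run-end<size n R)

Run-liftˡ : ∀ n {q k} → Run (hPowᵇ n) q k → Run (hPowᵇ (suc n)) q k
Run-liftˡ n R = Run-agree (λ j< → sym (hPowᵇ-sucˡ n j<)) (Run-end<size n R) R

Run-liftʳ : ∀ n {q k} → Run (hPowᵇ n) q k → Run (hPowᵇ (suc n)) (size n + q) k
Run-liftʳ n R = Run-unshift (size n) (Run-agree (λ j< → sym (hPowᵇ-sucʳ n j<)) (Run-end<size n R) R)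

-- The trailing bⁿ of the first copy of h^n(a), followed by the first a of the second copy.
Run-boundary : ∀ n → Run (hPowᵇ (suc n)) (lastA n) n
Run-boundary n = record
  { a-before = trans (hPowᵇ-sucˡ n (lastA<size n)) (hPowᵇ-lastA n)
  ; b-inside = λ j lastA<j j≤ → trans (hPowᵇ-sucˡ n (s≤s j≤)) (hPowᵇ-after-lastA n lastA<j)
  ; a-after  = hPowᵇ-size n
  }

data RunSplit (n : ℕ) : ℕ → ℕ → Set where
  first    : ∀ {q k} → Run (hPowᵇ n) q k → RunSplit n q k
  second   : ∀ {q k} → Run (hPowᵇ n) q k → RunSplit n (size n + q) k
  boundary : RunSplit n (lastA n) n

-- A run straddling the two copies must contain neither the first a of the second copy nor the last a of the first.
Run-straddling : ∀ n {q k} → Run (hPowᵇ (suc n)) q k → q < size n → size n ≤ suc (q + k) →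
                 q ≡ lastA n × k ≡ n
Run-straddling n {q} {k} R q< size≤ = q≡lastA , k≡n
  where
  end≡size : suc (q + k) ≡ size n
  end≡size with m≤n⇒m<n∨m≡n size≤
  ... | inj₂ eq = sym eq
  ... | inj₁ size<end = ⊥-elim (Run-no-a-inside R q< (≤-pred size<end) (hPowᵇ-size n))
  q≤lastA : q ≤ lastA n
  q≤lastA = hPowᵇ-a⇒≤lastA n (trans (sym (hPowᵇ-sucˡ n q<)) (a-before R))
  q≡lastA : q ≡ lastA n
  q≡lastA with m≤n⇒m<n∨m≡n q≤lastA
  ... | inj₂ eq = eq
  ... | inj₁ q<lastA = ⊥-elim (Run-no-a-inside R q<lastA
          (≤-pred (subst (lastA n <_) (sym end≡size) (lastA<size n)))
          (trans (hPowᵇ-sucˡ n (lastA<size n)) (hPowᵇ-lastA n)))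
  k≡n : k ≡ n
  k≡n = +-cancelˡ-≡ (lastA n) k n (suc-injective (subst (λ p → suc (p + k) ≡ size n) q≡lastA end≡size))

Run-split : ∀ n {q k} → Run (hPowᵇ (suc n)) q k → RunSplit n q k
Run-split n {q} {k} R with suc (q + k) <? size n
... | yes end< = first (Run-agree (hPowᵇ-sucˡ n) end< R)
... | no end≮ with q <? size n
...   | yes q< with Run-straddling n R q< (≮⇒≥ end≮)
...     | refl , refl = boundary
Run-split n {q} {k} R | no end≮ | no q≮ with m≤n⇒∃[o]m+o≡n (≮⇒≥ q≮)
...     | q₀ , refl = second (Run-agree (hPowᵇ-sucʳ n) end₀< (Run-shift (size n) R))
  where
  end₀< : suc (q₀ + k) < size n
  end₀< with suc (q₀ + k) <? size n
  ... | yes lt = lt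
  ... | no ≮ = ⊥-elim (a≢b (trans (sym (a-after R)) (hPowᵇ-suc-tail n
                 (subst (size n + size n ≤_) (+-suc-assoc (size n) q₀ k) (+-monoʳ-≤ (size n) (≮⇒≥ ≮))))))

Run-length< : ∀ n {q k} → Run (hPowᵇ n) q k → k < n
Run-length< zero R with Run-end≤lastA zero R
... | ()
Run-length< (suc n) R with Run-split n R
... | first R′  = m<n⇒m<1+n (Run-length< n R′)
... | second R′ = m<n⇒m<1+n (Run-length< n R′)
... | boundary  = n<1+n n

record LongerRunBetween (f : ℕ → Letter) (q q′ k : ℕ) : Set where
  field
    {start len} : ℕ
    longer : k < len
    run    : Run f start len
    after  : q + k < start
    before : start + len < q′

longerRunBetween : ∀ n {q q′ k} → Run (hPowᵇ n) q k → Run (hPowᵇ n) q′ k → q < q′ →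
                   LongerRunBetween (hPowᵇ n) q q′ k
longerRunBetween zero R _ _ with Run-length< zero R
... | ()
longerRunBetween (suc n) R R′ q<q′ with Run-split n R | Run-split n R′
... | first R₁ | first R₂ = liftˡ (longerRunBetween n R₁ R₂ q<q′)
  where
  liftˡ : ∀ {q q′ k} → LongerRunBetween (hPowᵇ n) q q′ k → LongerRunBetween (hPowᵇ (suc n)) q q′ k
  liftˡ B = record { longer = longer B ; run = Run-liftˡ n (run B) ; after = after B ; before = before B }
    where open LongerRunBetween
... | first R₁ | second {q₀′} R₂ = record
  { longer = Run-length< n R₁
  ; run    = Run-boundary n
  ; after  = Run-end≤lastA n R₁
  ; before = m≤m+n (size n) q₀′
  }
... | second R₁ | second R₂ = liftʳ (longerRunBetween n R₁ R₂ (+-cancelˡ-< (size n) _ _ q<q′))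
  where
  liftʳ : ∀ {q q′ k} → LongerRunBetween (hPowᵇ n) q q′ k →
          LongerRunBetween (hPowᵇ (suc n)) (size n + q) (size n + q′) k
  liftʳ {q} {q′} {k} B = record
    { longer = longer B
    ; run    = Run-liftʳ n (run B)
    ; after  = subst (_< size n + start B) (sym (+-assoc (size n) q k)) (+-monoʳ-< (size n) (after B))
    ; before = subst (_< size n + q′) (sym (+-assoc (size n) (start B) (len B))) (+-monoʳ-< (size n) (before B))
    }
    where open LongerRunBetween
... | second {q₀} R₁ | first R₂ =
  ⊥-elim (<⇒≱ q<q′ (≤-trans (<⇒≤ (Run-start<size n R₂)) (m≤m+n (size n) q₀)))
... | first R₁  | boundary  = ⊥-elim (<-irrefl refl (Run-length< n R₁))
... | second R₁ | boundary  = ⊥-elim (<-irrefl refl (Run-length< n R₁))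
... | boundary  | first R₂  = ⊥-elim (<-irrefl refl (Run-length< n R₂))
... | boundary  | second R₂ = ⊥-elim (<-irrefl refl (Run-length< n R₂))
... | boundary  | boundary  = ⊥-elim (<-irrefl refl q<q′)

‼-just : ∀ {A : Set} (xs : List A) {i} → i < length xs → ∃ λ x → xs ‼ i ≡ just x
‼-just (x ∷ xs) {zero}  _        = x , refl
‼-just (x ∷ xs) {suc i} (s≤s i<) = ‼-just xs i<

hPow-‼-prefix : ∀ {m n i} → m ≤ n → i < size m → hPow n ‼ i ≡ hPow m ‼ i
hPow-‼-prefix {m} m≤n i< with hPow-prefix (≤⇒≤′ m≤n)
... | ys , eq = trans (cong (_‼ _) eq) (‼-++ˡ (hPow m) ys (subst (_ <_) (sym (length-hPow m)) i<))

hPow-‼-stable : ∀ m n {i} → i < size m → i < size n → hPow m ‼ i ≡ hPow n ‼ i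
hPow-‼-stable m n i<m i<n with ≤-total m n
... | inj₁ m≤n = sym (hPow-‼-prefix m≤n i<m)
... | inj₂ n≤m = hPow-‼-prefix n≤m i<n

n<size : ∀ n → n < size n
n<size n = s≤s (m≤n+m n (lastA n))

z≡hPowᵇ : ∀ n {i} → i < size n → z i ≡ hPowᵇ n i
z≡hPowᵇ n {i} i< with ‼-just (hPow n) (subst (i <_) (sym (length-hPow n)) i<)
... | x , eq = begin
  fromMaybe (hPow i ‼ i)   ≡⟨ cong fromMaybe (trans (hPow-‼-stable i n (n<size i) i<) eq) ⟩
  x                        ≡⟨ cong (Maybe.fromMaybe b) eq ⟨
  hPowᵇ n i                ∎
  where open ≡-Reasoning

longerRunBetween-z : ∀ {q q′ k} → Run z q k → Run z q′ k → q < q′ → LongerRunBetween z q q′ k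
longerRunBetween-z {q} {q′} {k} R R′ q<q′ = record
  { longer = longer B
  ; run    = Run-agree (λ j< → sym (z≡hPowᵇ n j<))
               (<-trans (s≤s (≤-trans (before B) (m≤m+n q′ k))) (n<size n)) (run B)
  ; after  = after B
  ; before = before B
  }
  where
  open LongerRunBetween
  n : ℕ
  n = suc (q′ + k)
  B : LongerRunBetween (hPowᵇ n) q q′ k
  B = longerRunBetween n
        (Run-agree (z≡hPowᵇ n) (<-trans (s≤s (+-monoˡ-< k q<q′)) (n<size n)) R)
        (Run-agree (z≡hPowᵇ n) (n<size n) R′)
        q<q′

factorAt-‼ : ∀ i n {j} → j < n → factorAt i n ‼ j ≡ just (z (i + j))
factorAt-‼ i (suc n) {zero}  _        = cong (just ∘ z) (sym (+-identityʳ i))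
factorAt-‼ i (suc n) {suc j} (s≤s j<) = trans (factorAt-‼ (suc i) n j<) (cong (just ∘ z) (sym (+-suc i j)))

factor-‼ : ∀ {w i} → w ≡ factorAt i (length w) → ∀ {j} → j < length w → w ‼ j ≡ just (z (i + j))
factor-‼ {w} {i} w≡ j< = trans (cong (_‼ _) w≡) (factorAt-‼ i (length w) j<)

module _ (w : List Letter) (i : ℕ) (w≡z : ∀ {j} → j < length w → w ‼ j ≡ just (z (i + j))) where

  z-letter : ∀ {j x} → j < length w → w ‼ j ≡ just x → z (i + j) ≡ x
  z-letter j< eq = just-injective (trans (sym (w≡z j<)) eq)

  w-letter : ∀ {j x} → j < length w → z (i + j) ≡ x → w ‼ j ≡ just x
  w-letter j< eq = trans (w≡z j<) (cong just eq)

  interior-run : ∀ {p k} → IsBRun w (suc p) k → Interior w (suc p) k → Run z (i + p) k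
  interior-run {p} {k} (_ , end≤ , bs , a-left , a-right) (_ , end<) = record
    { a-before = z-letter p< (a-left′ a-left)
    ; b-inside = b-inside′
    ; a-after  = trans (cong z (sym (+-suc-assoc i p k))) (z-letter end< (a-right′ a-right))
    }
    where
    p< : p < length w
    p< = ≤-trans (s≤s (m≤m+n p k)) end≤
    a-left′ : (suc p ≡ 0) ⊎ (w ‼ p ≡ just a) → w ‼ p ≡ just a
    a-left′ (inj₂ eq) = eq
    a-right′ : (suc p + k ≡ length w) ⊎ (w ‼ (suc p + k) ≡ just a) → w ‼ (suc p + k) ≡ just a
    a-right′ (inj₁ eq) = ⊥-elim (<-irrefl eq end<)
    a-right′ (inj₂ eq) = eq
    b-inside′ : ∀ j → i + p < j → j ≤ i + p + k → z j ≡ b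
    b-inside′ j i+p<j j≤ with m≤n⇒∃[o]m+o≡n (≤-trans (m≤m+n i p) (<⇒≤ i+p<j))
    ... | j₀ , refl = z-letter (≤-trans (s≤s j₀≤) end≤) (bs j₀ (+-cancelˡ-< i _ _ i+p<j) (s≤s j₀≤))
      where
      j₀≤ : j₀ ≤ p + k
      j₀≤ = +-cancelˡ-≤ i _ _ (subst (i + j₀ ≤_) (+-assoc i p k) j≤)

  run-in-factor : ∀ {q m} → Run z (i + q) m → 1 ≤ m → suc (q + m) < length w → IsBRun w (suc q) m
  run-in-factor {q} {m} R 1≤m end< =
    1≤m , <⇒≤ end< , bs , inj₂ (w-letter q< (a-before R)) ,
    inj₂ (w-letter end< (trans (cong z (+-suc-assoc i q m)) (a-after R)))
    where
    q< : q < length w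
    q< = <-trans (s≤s (m≤m+n q m)) end<
    bs : ∀ j → suc q ≤ j → j < suc q + m → w ‼ j ≡ just b
    bs j q<j (s≤s j≤) = w-letter (<-trans (s≤s j≤) end<)
      (b-inside R (i + j) (+-monoʳ-< i q<j) (subst (i + j ≤_) (sym (+-assoc i q m)) (+-monoʳ-≤ i j≤)))

  interior-longest-runs-≮ : ∀ {k p p′} → IsLongestBRunLength w k →
    IsBRun w (suc p) k → Interior w (suc p) k → IsBRun w (suc p′) k → Interior w (suc p′) k → p ≮ p′
  interior-longest-runs-≮ {k} {p} {p′} (_ , longest) R I R′@(_ , end′≤ , _) I′ p<p′ =
    <⇒≱ (longer B) (longest (suc q) (len B) (run-in-factor run′ (≤-trans (s≤s z≤n) (longer B)) end<))
    where
    open LongerRunBetween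
    B : LongerRunBetween z (i + p) (i + p′) k
    B = longerRunBetween-z (interior-run R I) (interior-run R′ I′) (+-monoʳ-< i p<p′)
    i≤start : i ≤ start B
    i≤start = ≤-trans (m≤m+n i (p + k)) (≤-trans (≤-reflexive (sym (+-assoc i p k))) (<⇒≤ (after B)))
    q : ℕ
    q = start B ∸ i
    i+q≡start : i + q ≡ start B
    i+q≡start = m+[n∸m]≡n i≤start
    run′ : Run z (i + q) (len B)
    run′ = subst (λ s → Run z s (len B)) (sym i+q≡start) (run B)
    end< : suc (q + len B) < length w
    end< = ≤-<-trans (+-cancelˡ-< i _ _ (subst (_< i + p′) (trans (cong (_+ len B) (sym i+q≡start)) (+-assoc i q _)) (before B)))
                     (≤-trans (s≤s (m≤m+n p′ k)) end′≤)

lemma7 : (w : List Letter) → Factor w → (k : ℕ) → IsLongestBRunLength w k →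
         (p p′ : ℕ) → IsBRun w p k → Interior w p k →
         IsBRun w p′ k → Interior w p′ k → p ≡ p′
lemma7 _ _ _ _ zero    _        _ (() , _) _ _
lemma7 _ _ _ _ (suc p) zero     _ _ _ (() , _)
lemma7 w (i , w≡) k longest (suc p) (suc p′) R I R′ I′ with <-cmp p p′
... | tri< p<p′ _ _ = contradiction p<p′ (interior-longest-runs-≮ w i (factor-‼ w≡) longest R I R′ I′)
... | tri≈ _ p≡p′ _ = cong suc p≡p′
... | tri> _ _ p′<p = contradiction p′<p (interior-longest-runs-≮ w i (factor-‼ w≡) longest R′ I′ R I)
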